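{- For all nonnegative integers $n$ and $\ell$ with $\ell>2n$, $$\sum_{i+j=n}\binom{2i-\ell}{i}\binom{2j+\ell}{j}=4^n,$$ where the sum ranges over nonnegative integers $i,j$ with $i+j=n$.
   Context: For a real number $x$ and a nonnegative integer $i$, $\binom{x}{i}=\frac{x(x-1)\cdots(x-i+1)}{i!}$ (generalized binomial coefficient; in particular $\binom{x}{0}=1$). -}

module Defs where

open import Data.Nat as ℕ using (ℕ; zero; suc; _!)
open import Data.Nat.Properties using (_!≢0)
open import Data.Integer as ℤ using (ℤ; +_)
open import Data.Rational as ℚ using (ℚ)

fallingℤ : ℤ → ℕ → ℤ
fallingℤ x zero    = + 1
fallingℤ x (suc i) = fallingℤ x i ℤ.* (x ℤ.- + i)

binom : ℤ → ℕ → ℚ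
binom x i = (fallingℤ x i) ℚ./ (i !)
  where instance _ = i !≢0

sumTo : ℕ → (ℕ → ℚ) → ℚ
sumTo zero    f = f zero
sumTo (suc n) f = sumTo n f ℚ.+ f (suc n)

module Submission where

-- Write  C r k = binom(2k + r, k)  and  S r s n = Σ_{i+j=n} C r i · C s j.  The
-- theorem says S (-ℓ) ℓ n = 4^n.
--
-- From the Pascal rule for
--    falling factorials we get Pascal's rule for binom, and from the definition
--    the ratio rule  binom x (k+1)·(k+1) = binom x k·(x−k).
-- 2. Pascal's rule gives  C (r+1) (k+1) = C r (k+1) + C (r+2) k, and the ratio
--    rule gives the symmetry binom(2n+1, n+1) = binom(2n+1, n), hence
--    C 0 (k+1) = 2·C 1 k.
-- 3. Splitting the convolution at either end, induction on n shows
--    S (r+1) s n = S r (s+1) n: S only depends on r + s, so S (-ℓ) ℓ = S 0 0.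
-- 4. Peeling off the first term of S 0 m (n+1) gives the recursion
--    S 0 m (n+1) = C m (n+1) + 2·S 0 (m+1) n, also satisfied by the partial row
--    sums  T m n = Σ_{k≤n} binom(2n+1+m, k).  Hence S 0 0 n = T 0 n, and the
--    half-row identity  T 1 n + binom(2n+1, n) = 2·T 0 n  gives T 0 n = 4^n.

open import Defs
open import Data.Nat as ℕ using (ℕ; zero; suc; _!; _∸_; _<_; _≤_; z≤n; NonZero)
open import Data.Nat.Properties as ℕP using (_!≢0)
open import Data.Integer as ℤ using (ℤ; +_)
import Data.Integer.Properties as ℤP
open import Data.Integer.Tactic.RingSolver using (solve-∀)
open import Data.Rational as ℚ using (ℚ; 1ℚ)
import Data.Rational.Properties as ℚP
open import Data.Rational.Unnormalised as ℚᵘ using (mkℚᵘ; *≡*)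
import Data.Rational.Unnormalised.Properties as ℚᵘP
open import Data.Maybe.Base using (nothing)
open import Level using (0ℓ)
import Tactic.RingSolver as RingSolver
open import Tactic.RingSolver.Core.AlmostCommutativeRing
  using (AlmostCommutativeRing; fromCommutativeRing)
open import Relation.Binary.PropositionalEquality
open ≡-Reasoning

ℚ-ring : AlmostCommutativeRing 0ℓ 0ℓ
ℚ-ring = fromCommutativeRing ℚP.+-*-commutativeRing (λ _ → nothing)

ι : ℤ → ℚ
ι i = i ℚ./ 1

toℚᵘ-/ : ∀ i m → ℚ.toℚᵘ (i ℚ./ suc m) ℚᵘ.≃ mkℚᵘ i m
toℚᵘ-/ i m = ℚP.toℚᵘ-fromℚᵘ (mkℚᵘ i m)

ι-+ : ∀ a b → ι (a ℤ.+ b) ≡ ι a ℚ.+ ι b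
ι-+ a b = ℚP.toℚᵘ-injective (ℚᵘP.≃-trans (toℚᵘ-/ (a ℤ.+ b) 0) (ℚᵘP.≃-sym
  (ℚᵘP.≃-trans (ℚP.toℚᵘ-homo-+ (ι a) (ι b))
  (ℚᵘP.≃-trans (ℚᵘP.+-cong (toℚᵘ-/ a 0) (toℚᵘ-/ b 0)) (*≡* (cross a b))))))
  where
  cross : ∀ a b → (a ℤ.* + 1 ℤ.+ b ℤ.* + 1) ℤ.* + 1 ≡ (a ℤ.+ b) ℤ.* + 1
  cross = solve-∀

ι-* : ∀ a b → ι (a ℤ.* b) ≡ ι a ℚ.* ι b
ι-* a b = ℚP.toℚᵘ-injective (ℚᵘP.≃-trans (toℚᵘ-/ (a ℤ.* b) 0) (ℚᵘP.≃-sym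
  (ℚᵘP.≃-trans (ℚP.toℚᵘ-homo-* (ι a) (ι b))
  (ℚᵘP.*-cong (toℚᵘ-/ a 0) (toℚᵘ-/ b 0)))))

/-as-ι : ∀ i n .{{_ : NonZero n}} → i ℚ./ n ≡ ι i ℚ.* (+ 1 ℚ./ n)
/-as-ι i (suc m) = ℚP.toℚᵘ-injective (ℚᵘP.≃-trans (toℚᵘ-/ i m) (ℚᵘP.≃-sym
  (ℚᵘP.≃-trans (ℚP.toℚᵘ-homo-* (ι i) (+ 1 ℚ./ suc m))
  (ℚᵘP.≃-trans (ℚᵘP.*-cong (toℚᵘ-/ i 0) (toℚᵘ-/ (+ 1) m)) (*≡* (cross i (+ suc m)))))))
  where
  cross : ∀ i s → (i ℤ.* + 1) ℤ.* s ≡ i ℤ.* (+ 1 ℤ.* s)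
  cross = solve-∀

ι-recip : ∀ m → ι (+ suc m) ℚ.* (+ 1 ℚ./ suc m) ≡ 1ℚ
ι-recip m = ℚP.toℚᵘ-injective (ℚᵘP.≃-trans (ℚP.toℚᵘ-homo-* (ι (+ suc m)) (+ 1 ℚ./ suc m))
  (ℚᵘP.≃-trans (ℚᵘP.*-cong (toℚᵘ-/ (+ suc m) 0) (toℚᵘ-/ (+ 1) m)) (*≡* (cross (+ suc m)))))
  where
  cross : ∀ s → (s ℤ.* + 1) ℤ.* + 1 ≡ + 1 ℤ.* (+ 1 ℤ.* s)
  cross = solve-∀

recip-* : ∀ m n .{{_ : NonZero m}} .{{_ : NonZero n}} →
          (+ 1 ℚ./ (m ℕ.* n)) {{ℕP.m*n≢0 m n}} ≡ (+ 1 ℚ./ m) ℚ.* (+ 1 ℚ./ n)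
recip-* (suc m) (suc n) = ℚP.toℚᵘ-injective (ℚᵘP.≃-trans (toℚᵘ-/ (+ 1) (n ℕ.+ m ℕ.* suc n)) (ℚᵘP.≃-sym
  (ℚᵘP.≃-trans (ℚP.toℚᵘ-homo-* (+ 1 ℚ./ suc m) (+ 1 ℚ./ suc n))
  (ℚᵘP.≃-trans (ℚᵘP.*-cong (toℚᵘ-/ (+ 1) m) (toℚᵘ-/ (+ 1) n)) (*≡* refl)))))

*-cancel-suc : ∀ a {p q} → p ℚ.* ι (+ suc a) ≡ q ℚ.* ι (+ suc a) → p ≡ q
*-cancel-suc a {p} {q} eq = begin
  p                  ≡⟨ undo p ⟩
  p ℚ.* s ℚ.* s⁻¹    ≡⟨ cong (ℚ._* s⁻¹) eq ⟩
  q ℚ.* s ℚ.* s⁻¹    ≡⟨ sym (undo q) ⟩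
  q                  ∎
  where
  s = ι (+ suc a)
  s⁻¹ = + 1 ℚ./ suc a
  regroup : ∀ x y z → x ℚ.* (y ℚ.* z) ≡ x ℚ.* y ℚ.* z
  regroup = RingSolver.solve-∀ ℚ-ring
  undo : ∀ x → x ≡ x ℚ.* s ℚ.* s⁻¹
  undo x = trans (sym (trans (cong (x ℚ.*_) (ι-recip a)) (ℚP.*-identityʳ x))) (regroup x s s⁻¹)

invFact : ℕ → ℚ
invFact k = (+ 1 ℚ./ (k !)) {{k !≢0}}

binom-falling : ∀ x k → binom x k ≡ ι (fallingℤ x k) ℚ.* invFact k
binom-falling x k = /-as-ι (fallingℤ x k) (k !) {{k !≢0}}

invFact-suc : ∀ k → invFact (suc k) ℚ.* ι (+ suc k) ≡ invFact k
invFact-suc k = begin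
  invFact (suc k) ℚ.* ι (+ suc k)                  ≡⟨ cong (ℚ._* ι (+ suc k)) (recip-* (suc k) (k !) {{_}} {{k !≢0}}) ⟩
  (+ 1 ℚ./ suc k) ℚ.* invFact k ℚ.* ι (+ suc k)   ≡⟨ rearrange (+ 1 ℚ./ suc k) (invFact k) (ι (+ suc k)) ⟩
  ι (+ suc k) ℚ.* (+ 1 ℚ./ suc k) ℚ.* invFact k   ≡⟨ cong (ℚ._* invFact k) (ι-recip k) ⟩
  1ℚ ℚ.* invFact k                                 ≡⟨ ℚP.*-identityˡ (invFact k) ⟩
  invFact k                                        ∎
  where
  rearrange : ∀ x y z → x ℚ.* y ℚ.* z ≡ z ℚ.* x ℚ.* y
  rearrange = RingSolver.solve-∀ ℚ-ring

falling-pascal : ∀ x k → fallingℤ (x ℤ.+ + 1) (suc k) ≡ fallingℤ x (suc k) ℤ.+ + suc k ℤ.* fallingℤ x k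
falling-pascal x zero = base x
  where
  base : ∀ x → + 1 ℤ.* (x ℤ.+ + 1 ℤ.- + 0) ≡ + 1 ℤ.* (x ℤ.- + 0) ℤ.+ + 1 ℤ.* + 1
  base = solve-∀
falling-pascal x (suc k) = begin
  fallingℤ (x ℤ.+ + 1) (suc k) ℤ.* (x ℤ.+ + 1 ℤ.- + suc k)
    ≡⟨ cong (ℤ._* (x ℤ.+ + 1 ℤ.- + suc k)) (falling-pascal x k) ⟩
  (A ℤ.* (x ℤ.- + k) ℤ.+ + suc k ℤ.* A) ℤ.* (x ℤ.+ + 1 ℤ.- + suc k)
    ≡⟨ step A x (+ k) ⟩
  A ℤ.* (x ℤ.- + k) ℤ.* (x ℤ.- + suc k) ℤ.+ + suc (suc k) ℤ.* (A ℤ.* (x ℤ.- + k)) ∎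
  where
  A = fallingℤ x k
  step : ∀ A x K → (A ℤ.* (x ℤ.- K) ℤ.+ (+ 1 ℤ.+ K) ℤ.* A) ℤ.* (x ℤ.+ + 1 ℤ.- (+ 1 ℤ.+ K))
         ≡ A ℤ.* (x ℤ.- K) ℤ.* (x ℤ.- (+ 1 ℤ.+ K)) ℤ.+ (+ 2 ℤ.+ K) ℤ.* (A ℤ.* (x ℤ.- K))
  step = solve-∀

-- Pascal's rule  binom(x+1, k+1) = binom(x, k+1) + binom(x, k),
-- the falling-factorial rule divided by (k+1)!.
binom-pascal : ∀ x k → binom (x ℤ.+ + 1) (suc k) ≡ binom x (suc k) ℚ.+ binom x k
binom-pascal x k = begin
  binom (x ℤ.+ + 1) (suc k)
    ≡⟨ binom-falling (x ℤ.+ + 1) (suc k) ⟩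
  ι (fallingℤ (x ℤ.+ + 1) (suc k)) ℚ.* c
    ≡⟨ cong (λ z → ι z ℚ.* c) (falling-pascal x k) ⟩
  ι (A ℤ.+ + suc k ℤ.* B) ℚ.* c
    ≡⟨ cong (ℚ._* c) (trans (ι-+ A _) (cong (ι A ℚ.+_) (ι-* (+ suc k) B))) ⟩
  (ι A ℚ.+ s ℚ.* ι B) ℚ.* c
    ≡⟨ rearrange (ι A) s (ι B) c ⟩
  ι A ℚ.* c ℚ.+ ι B ℚ.* (c ℚ.* s)
    ≡⟨ cong₂ ℚ._+_ (sym (binom-falling x (suc k)))
                   (trans (cong (ι B ℚ.*_) (invFact-suc k)) (sym (binom-falling x k))) ⟩
  binom x (suc k) ℚ.+ binom x k ∎
  where
  A = fallingℤ x (suc k)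
  B = fallingℤ x k
  c = invFact (suc k)
  s = ι (+ suc k)
  rearrange : ∀ a s b c → (a ℚ.+ s ℚ.* b) ℚ.* c ≡ a ℚ.* c ℚ.+ b ℚ.* (c ℚ.* s)
  rearrange = RingSolver.solve-∀ ℚ-ring

binom-suc : ∀ x k → binom x (suc k) ℚ.* ι (+ suc k) ≡ binom x k ℚ.* ι (x ℤ.- + k)
binom-suc x k = begin
  binom x (suc k) ℚ.* s
    ≡⟨ cong (ℚ._* s) (binom-falling x (suc k)) ⟩
  ι (fallingℤ x k ℤ.* (x ℤ.- + k)) ℚ.* invFact (suc k) ℚ.* s
    ≡⟨ cong (λ z → z ℚ.* invFact (suc k) ℚ.* s) (ι-* (fallingℤ x k) (x ℤ.- + k)) ⟩
  ι (fallingℤ x k) ℚ.* ι (x ℤ.- + k) ℚ.* invFact (suc k) ℚ.* s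
    ≡⟨ rearrange (ι (fallingℤ x k)) (ι (x ℤ.- + k)) (invFact (suc k)) s ⟩
  ι (fallingℤ x k) ℚ.* (invFact (suc k) ℚ.* s) ℚ.* ι (x ℤ.- + k)
    ≡⟨ cong (λ z → ι (fallingℤ x k) ℚ.* z ℚ.* ι (x ℤ.- + k)) (invFact-suc k) ⟩
  ι (fallingℤ x k) ℚ.* invFact k ℚ.* ι (x ℤ.- + k)
    ≡⟨ cong (ℚ._* ι (x ℤ.- + k)) (sym (binom-falling x k)) ⟩
  binom x k ℚ.* ι (x ℤ.- + k) ∎
  where
  s = ι (+ suc k)
  rearrange : ∀ a b c s → a ℚ.* b ℚ.* c ℚ.* s ≡ a ℚ.* (c ℚ.* s) ℚ.* b
  rearrange = RingSolver.solve-∀ ℚ-ring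

twice : ∀ k → + (2 ℕ.* k) ≡ + k ℤ.+ + k
twice k = cong (λ z → + (k ℕ.+ z)) (ℕP.+-identityʳ k)

twice-suc : ∀ k → + (2 ℕ.* suc k) ≡ + (2 ℕ.* k) ℤ.+ + 2
twice-suc k = cong +_ (trans (ℕP.*-suc 2 k) (ℕP.+-comm 2 (2 ℕ.* k)))

-- The two middle entries of the odd row 2n+1 agree:
-- binom(2n+1, n+1) = binom(2n+1, n), since (x−n) = n+1 for x = 2n+1.
binom-middle : ∀ n → binom (+ (2 ℕ.* n) ℤ.+ + 1) (suc n) ≡ binom (+ (2 ℕ.* n) ℤ.+ + 1) n
binom-middle n = *-cancel-suc n (begin
  binom x (suc n) ℚ.* ι (+ suc n)  ≡⟨ binom-suc x n ⟩
  binom x n ℚ.* ι (x ℤ.- + n)      ≡⟨ cong (λ z → binom x n ℚ.* ι (z ℤ.+ + 1 ℤ.- + n)) (twice n) ⟩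
  binom x n ℚ.* ι (+ n ℤ.+ + n ℤ.+ + 1 ℤ.- + n)  ≡⟨ cong (λ z → binom x n ℚ.* ι z) (cancel (+ n)) ⟩
  binom x n ℚ.* ι (+ suc n)        ∎)
  where
  x = + (2 ℕ.* n) ℤ.+ + 1
  cancel : ∀ N → N ℤ.+ N ℤ.+ + 1 ℤ.- N ≡ + 1 ℤ.+ N
  cancel = solve-∀

C : ℤ → ℕ → ℚ
C r k = binom (+ (2 ℕ.* k) ℤ.+ r) k

C-pascal : ∀ r k → C (r ℤ.+ + 1) (suc k) ≡ C r (suc k) ℚ.+ C (r ℤ.+ + 2) k
C-pascal r k = begin
  binom (+ (2 ℕ.* suc k) ℤ.+ (r ℤ.+ + 1)) (suc k)
    ≡⟨ cong (λ z → binom z (suc k)) (sym (ℤP.+-assoc (+ (2 ℕ.* suc k)) r (+ 1))) ⟩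
  binom (x ℤ.+ + 1) (suc k)                     ≡⟨ binom-pascal x k ⟩
  C r (suc k) ℚ.+ binom x k                     ≡⟨ cong (λ z → C r (suc k) ℚ.+ binom z k) x≡ ⟩
  C r (suc k) ℚ.+ C (r ℤ.+ + 2) k               ∎
  where
  x = + (2 ℕ.* suc k) ℤ.+ r
  regroup : ∀ d r → d ℤ.+ + 2 ℤ.+ r ≡ d ℤ.+ (r ℤ.+ + 2)
  regroup = solve-∀
  x≡ : x ≡ + (2 ℕ.* k) ℤ.+ (r ℤ.+ + 2)
  x≡ = trans (cong (ℤ._+ r) (twice-suc k)) (regroup (+ (2 ℕ.* k)) r)

C-zero-suc : ∀ k → C (+ 0) (suc k) ≡ C (+ 1) k ℚ.+ C (+ 1) k
C-zero-suc k = begin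
  C (+ 0) (suc k)                  ≡⟨ cong (λ z → binom z (suc k)) x+1 ⟩
  binom (x ℤ.+ + 1) (suc k)        ≡⟨ binom-pascal x k ⟩
  binom x (suc k) ℚ.+ binom x k    ≡⟨ cong (ℚ._+ binom x k) (binom-middle k) ⟩
  binom x k ℚ.+ binom x k          ∎
  where
  x = + (2 ℕ.* k) ℤ.+ + 1
  regroup : ∀ d → d ℤ.+ + 2 ℤ.+ + 0 ≡ d ℤ.+ + 1 ℤ.+ + 1
  regroup = solve-∀
  x+1 : + (2 ℕ.* suc k) ℤ.+ + 0 ≡ x ℤ.+ + 1
  x+1 = trans (cong (ℤ._+ + 0) (twice-suc k)) (regroup (+ (2 ℕ.* k)))

sum-cong : ∀ n {g h : ℕ → ℚ} → (∀ k → k ≤ n → g k ≡ h k) → sumTo n g ≡ sumTo n h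
sum-cong zero    eq = eq 0 z≤n
sum-cong (suc n) eq = cong₂ ℚ._+_ (sum-cong n (λ k k≤n → eq k (ℕP.m≤n⇒m≤1+n k≤n))) (eq (suc n) ℕP.≤-refl)

sum-shift : ∀ n g → sumTo (suc n) g ≡ g 0 ℚ.+ sumTo n (λ k → g (suc k))
sum-shift zero    g = refl
sum-shift (suc n) g = trans (cong (ℚ._+ g (suc (suc n))) (sum-shift n g))
  (ℚP.+-assoc (g 0) (sumTo n (λ k → g (suc k))) (g (suc (suc n))))

sum-+ : ∀ n g h → sumTo n (λ k → g k ℚ.+ h k) ≡ sumTo n g ℚ.+ sumTo n h
sum-+ zero    g h = refl
sum-+ (suc n) g h = trans (cong (ℚ._+ (g (suc n) ℚ.+ h (suc n))) (sum-+ n g h))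
  (interchange (sumTo n g) (sumTo n h) (g (suc n)) (h (suc n)))
  where
  interchange : ∀ a b c d → a ℚ.+ b ℚ.+ (c ℚ.+ d) ≡ a ℚ.+ c ℚ.+ (b ℚ.+ d)
  interchange = RingSolver.solve-∀ ℚ-ring

conv : ℕ → (ℕ → ℚ) → (ℕ → ℚ) → ℚ
conv n a b = sumTo n (λ k → a k ℚ.* b (n ∸ k))

conv-front : ∀ n a b → conv (suc n) a b ≡ a 0 ℚ.* b (suc n) ℚ.+ conv n (λ k → a (suc k)) b
conv-front n a b = sum-shift n (λ k → a k ℚ.* b (suc n ∸ k))

conv-back : ∀ n a b → conv (suc n) a b ≡ conv n a (λ k → b (suc k)) ℚ.+ a (suc n) ℚ.* b 0
conv-back n a b = cong₂ ℚ._+_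
  (sum-cong n (λ k k≤n → cong (λ i → a k ℚ.* b i) (ℕP.+-∸-assoc 1 k≤n)))
  (cong (λ i → a (suc n) ℚ.* b i) (ℕP.n∸n≡0 n))

conv-splitˡ : ∀ n {a a₁ a₂} b → (∀ k → a k ≡ a₁ k ℚ.+ a₂ k) → conv n a b ≡ conv n a₁ b ℚ.+ conv n a₂ b
conv-splitˡ n {a} {a₁} {a₂} b split = trans
  (sum-cong n (λ k _ → trans (cong (ℚ._* b (n ∸ k)) (split k)) (ℚP.*-distribʳ-+ (b (n ∸ k)) (a₁ k) (a₂ k))))
  (sum-+ n _ _)

conv-splitʳ : ∀ n a {b b₁ b₂} → (∀ k → b k ≡ b₁ k ℚ.+ b₂ k) → conv n a b ≡ conv n a b₁ ℚ.+ conv n a b₂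
conv-splitʳ n a {b} {b₁} {b₂} split = trans
  (sum-cong n (λ k _ → trans (cong (a k ℚ.*_) (split (n ∸ k))) (ℚP.*-distribˡ-+ (a k) (b₁ (n ∸ k)) (b₂ (n ∸ k)))))
  (sum-+ n _ _)

S : ℤ → ℤ → ℕ → ℚ
S r s n = conv n (C r) (C s)

-- Recursions for S obtained by applying C-pascal in the left resp. right factor.
S-recˡ : ∀ r s n → S (r ℤ.+ + 1) s (suc n) ≡ S r s (suc n) ℚ.+ S (r ℤ.+ + 2) s n
S-recˡ r s n = begin
  S (r ℤ.+ + 1) s (suc n)                    ≡⟨ conv-front n (C (r ℤ.+ + 1)) (C s) ⟩
  h ℚ.+ conv n (λ k → C (r ℤ.+ + 1) (suc k)) (C s)
    ≡⟨ cong (h ℚ.+_) (conv-splitˡ n {a₁ = λ k → C r (suc k)} {a₂ = C (r ℤ.+ + 2)} (C s) (C-pascal r)) ⟩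
  h ℚ.+ (X ℚ.+ S (r ℤ.+ + 2) s n)           ≡⟨ sym (ℚP.+-assoc h X _) ⟩
  h ℚ.+ X ℚ.+ S (r ℤ.+ + 2) s n             ≡⟨ cong (ℚ._+ S (r ℤ.+ + 2) s n) (sym (conv-front n (C r) (C s))) ⟩
  S r s (suc n) ℚ.+ S (r ℤ.+ + 2) s n       ∎
  where
  h = C r 0 ℚ.* C s (suc n)
  X = conv n (λ k → C r (suc k)) (C s)

S-recʳ : ∀ r s n → S r (s ℤ.+ + 1) (suc n) ≡ S r s (suc n) ℚ.+ S r (s ℤ.+ + 2) n
S-recʳ r s n = begin
  S r (s ℤ.+ + 1) (suc n)                    ≡⟨ conv-back n (C r) (C (s ℤ.+ + 1)) ⟩
  conv n (C r) (λ k → C (s ℤ.+ + 1) (suc k)) ℚ.+ h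
    ≡⟨ cong (ℚ._+ h) (conv-splitʳ n (C r) {b₁ = λ k → C s (suc k)} {b₂ = C (s ℤ.+ + 2)} (C-pascal s)) ⟩
  X ℚ.+ S r (s ℤ.+ + 2) n ℚ.+ h              ≡⟨ swap X (S r (s ℤ.+ + 2) n) h ⟩
  X ℚ.+ h ℚ.+ S r (s ℤ.+ + 2) n              ≡⟨ cong (ℚ._+ S r (s ℤ.+ + 2) n) (sym (conv-back n (C r) (C s))) ⟩
  S r s (suc n) ℚ.+ S r (s ℤ.+ + 2) n       ∎
  where
  h = C r (suc n) ℚ.* C s 0
  X = conv n (C r) (λ k → C s (suc k))
  swap : ∀ x y z → x ℚ.+ y ℚ.+ z ≡ x ℚ.+ z ℚ.+ y
  swap = RingSolver.solve-∀ ℚ-ring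

-- S r s n only depends on r + s: a unit can be moved from r to s.
-- Both sides unfold by S-recˡ/S-recʳ to the same first summand, and the
-- second summands agree by moving two units one at a time (induction on n).
S-transfer : ∀ n r s → S (r ℤ.+ + 1) s n ≡ S r (s ℤ.+ + 1) n
S-transfer zero    r s = refl
S-transfer (suc n) r s = begin
  S (r ℤ.+ + 1) s (suc n)                 ≡⟨ S-recˡ r s n ⟩
  S r s (suc n) ℚ.+ S (r ℤ.+ + 2) s n     ≡⟨ cong (S r s (suc n) ℚ.+_) inner ⟩
  S r s (suc n) ℚ.+ S r (s ℤ.+ + 2) n     ≡⟨ sym (S-recʳ r s n) ⟩
  S r (s ℤ.+ + 1) (suc n)                 ∎
  where
  two : ∀ t → t ℤ.+ + 2 ≡ t ℤ.+ + 1 ℤ.+ + 1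
  two = solve-∀
  inner : S (r ℤ.+ + 2) s n ≡ S r (s ℤ.+ + 2) n
  inner = begin
    S (r ℤ.+ + 2) s n              ≡⟨ cong (λ t → S t s n) (two r) ⟩
    S (r ℤ.+ + 1 ℤ.+ + 1) s n      ≡⟨ S-transfer n (r ℤ.+ + 1) s ⟩
    S (r ℤ.+ + 1) (s ℤ.+ + 1) n    ≡⟨ S-transfer n r (s ℤ.+ + 1) ⟩
    S r (s ℤ.+ + 1 ℤ.+ + 1) n      ≡⟨ cong (λ t → S r t n) (sym (two s)) ⟩
    S r (s ℤ.+ + 2) n              ∎

S-transfer-ℕ : ∀ ℓ n r s → S (r ℤ.+ + ℓ) s n ≡ S r (s ℤ.+ + ℓ) n
S-transfer-ℕ zero n r s = cong₂ (λ r s → S r s n) (ℤP.+-identityʳ r) (sym (ℤP.+-identityʳ s))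
S-transfer-ℕ (suc ℓ) n r s = begin
  S (r ℤ.+ + suc ℓ) s n           ≡⟨ cong (λ t → S t s n) (split r) ⟩
  S (r ℤ.+ + ℓ ℤ.+ + 1) s n       ≡⟨ S-transfer n (r ℤ.+ + ℓ) s ⟩
  S (r ℤ.+ + ℓ) (s ℤ.+ + 1) n     ≡⟨ S-transfer-ℕ ℓ n r (s ℤ.+ + 1) ⟩
  S r (s ℤ.+ + 1 ℤ.+ + ℓ) n       ≡⟨ cong (λ t → S r t n) (merge s) ⟩
  S r (s ℤ.+ + suc ℓ) n           ∎
  where
  split : ∀ t → t ℤ.+ + suc ℓ ≡ t ℤ.+ + ℓ ℤ.+ + 1
  split t = trans (cong (λ u → t ℤ.+ u) (ℤP.+-comm (+ 1) (+ ℓ))) (sym (ℤP.+-assoc t (+ ℓ) (+ 1)))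
  merge : ∀ t → t ℤ.+ + 1 ℤ.+ + ℓ ≡ t ℤ.+ + suc ℓ
  merge t = ℤP.+-assoc t (+ 1) (+ ℓ)

rowSum : ℤ → ℕ → ℚ
rowSum x n = sumTo n (binom x)

rowSum-pascal : ∀ x n → rowSum (x ℤ.+ + 1) n ℚ.+ binom x n ≡ rowSum x n ℚ.+ rowSum x n
rowSum-pascal x zero    = refl
rowSum-pascal x (suc n) = begin
  rowSum (x ℤ.+ + 1) n ℚ.+ binom (x ℤ.+ + 1) (suc n) ℚ.+ b₁
    ≡⟨ cong (λ z → rowSum (x ℤ.+ + 1) n ℚ.+ z ℚ.+ b₁) (binom-pascal x n) ⟩
  rowSum (x ℤ.+ + 1) n ℚ.+ (b₁ ℚ.+ binom x n) ℚ.+ b₁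
    ≡⟨ regroup (rowSum (x ℤ.+ + 1) n) b₁ (binom x n) ⟩
  rowSum (x ℤ.+ + 1) n ℚ.+ binom x n ℚ.+ (b₁ ℚ.+ b₁)
    ≡⟨ cong (ℚ._+ (b₁ ℚ.+ b₁)) (rowSum-pascal x n) ⟩
  rowSum x n ℚ.+ rowSum x n ℚ.+ (b₁ ℚ.+ b₁)
    ≡⟨ interleave (rowSum x n) b₁ ⟩
  rowSum x (suc n) ℚ.+ rowSum x (suc n) ∎
  where
  b₁ = binom x (suc n)
  regroup : ∀ r b c → r ℚ.+ (b ℚ.+ c) ℚ.+ b ≡ r ℚ.+ c ℚ.+ (b ℚ.+ b)
  regroup = RingSolver.solve-∀ ℚ-ring
  interleave : ∀ r b → r ℚ.+ r ℚ.+ (b ℚ.+ b) ≡ r ℚ.+ b ℚ.+ (r ℚ.+ b)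
  interleave = RingSolver.solve-∀ ℚ-ring

-- T m n = Σ_{k≤n} binom(2n+1+m, k), the closed form of S 0 m n.
T : ℤ → ℕ → ℚ
T m n = rowSum (+ (2 ℕ.* n) ℤ.+ (m ℤ.+ + 1)) n

T-rec : ∀ m n → T m (suc n) ≡ C m (suc n) ℚ.+ (T (m ℤ.+ + 1) n ℚ.+ T (m ℤ.+ + 1) n)
T-rec m n = begin
  rowSum (+ (2 ℕ.* suc n) ℤ.+ (m ℤ.+ + 1)) (suc n)
    ≡⟨ cong (λ z → rowSum z (suc n)) (sym (ℤP.+-assoc (+ (2 ℕ.* suc n)) m (+ 1))) ⟩
  rowSum (x ℤ.+ + 1) n ℚ.+ binom (x ℤ.+ + 1) (suc n)
    ≡⟨ cong (rowSum (x ℤ.+ + 1) n ℚ.+_) (binom-pascal x n) ⟩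
  rowSum (x ℤ.+ + 1) n ℚ.+ (C m (suc n) ℚ.+ binom x n)
    ≡⟨ regroup (rowSum (x ℤ.+ + 1) n) (C m (suc n)) (binom x n) ⟩
  C m (suc n) ℚ.+ (rowSum (x ℤ.+ + 1) n ℚ.+ binom x n)
    ≡⟨ cong (C m (suc n) ℚ.+_) (rowSum-pascal x n) ⟩
  C m (suc n) ℚ.+ (rowSum x n ℚ.+ rowSum x n)
    ≡⟨ cong (λ z → C m (suc n) ℚ.+ (rowSum z n ℚ.+ rowSum z n)) x≡ ⟩
  C m (suc n) ℚ.+ (T (m ℤ.+ + 1) n ℚ.+ T (m ℤ.+ + 1) n) ∎
  where
  x = + (2 ℕ.* suc n) ℤ.+ m
  regroup : ∀ r c b → r ℚ.+ (c ℚ.+ b) ≡ c ℚ.+ (r ℚ.+ b)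
  regroup = RingSolver.solve-∀ ℚ-ring
  shift : ∀ d m → d ℤ.+ + 2 ℤ.+ m ≡ d ℤ.+ (m ℤ.+ + 1 ℤ.+ + 1)
  shift = solve-∀
  x≡ : x ≡ + (2 ℕ.* n) ℤ.+ (m ℤ.+ + 1 ℤ.+ + 1)
  x≡ = trans (cong (ℤ._+ m) (twice-suc n)) (shift (+ (2 ℕ.* n)) m)

-- S 0 satisfies the same recursion: the first term of the convolution is
-- C m (n+1), and the rest is 2·S 1 m n = 2·S 0 (m+1) n by C-zero-suc.
S-rec : ∀ m n → S (+ 0) m (suc n) ≡ C m (suc n) ℚ.+ (S (+ 0) (m ℤ.+ + 1) n ℚ.+ S (+ 0) (m ℤ.+ + 1) n)
S-rec m n = begin
  S (+ 0) m (suc n)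
    ≡⟨ conv-front n (C (+ 0)) (C m) ⟩
  1ℚ ℚ.* C m (suc n) ℚ.+ conv n (λ k → C (+ 0) (suc k)) (C m)
    ≡⟨ cong₂ ℚ._+_ (ℚP.*-identityˡ (C m (suc n)))
                   (conv-splitˡ n {a₁ = C (+ 1)} {a₂ = C (+ 1)} (C m) C-zero-suc) ⟩
  C m (suc n) ℚ.+ (S (+ 1) m n ℚ.+ S (+ 1) m n)
    ≡⟨ cong (λ z → C m (suc n) ℚ.+ (z ℚ.+ z)) (S-transfer n (+ 0) m) ⟩
  C m (suc n) ℚ.+ (S (+ 0) (m ℤ.+ + 1) n ℚ.+ S (+ 0) (m ℤ.+ + 1) n) ∎

S-as-T : ∀ n m → S (+ 0) m n ≡ T m n
S-as-T zero    m = refl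
S-as-T (suc n) m = begin
  S (+ 0) m (suc n)                                          ≡⟨ S-rec m n ⟩
  C m (suc n) ℚ.+ (S (+ 0) m′ n ℚ.+ S (+ 0) m′ n)            ≡⟨ cong (λ z → C m (suc n) ℚ.+ (z ℚ.+ z)) (S-as-T n m′) ⟩
  C m (suc n) ℚ.+ (T m′ n ℚ.+ T m′ n)                        ≡⟨ sym (T-rec m n) ⟩
  T m (suc n)                                                ∎
  where
  m′ = m ℤ.+ + 1

-- The partial row sum  Σ_{k≤n} binom(2n+1, k) = 4^n:  T 0 (n+1) = 2b + 2·T 1 n
-- with b = binom(2n+1, n), and T 1 n + b = 2·T 0 n by rowSum-pascal.
T-zero : ∀ n → T (+ 0) n ≡ ι (+ (4 ℕ.^ n))
T-zero zero    = refl
T-zero (suc n) = begin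
  T (+ 0) (suc n)                                ≡⟨ T-rec (+ 0) n ⟩
  C (+ 0) (suc n) ℚ.+ (T (+ 1) n ℚ.+ T (+ 1) n)  ≡⟨ cong (ℚ._+ (T (+ 1) n ℚ.+ T (+ 1) n)) (C-zero-suc n) ⟩
  b ℚ.+ b ℚ.+ (T (+ 1) n ℚ.+ T (+ 1) n)          ≡⟨ pair b (T (+ 1) n) ⟩
  (T (+ 1) n ℚ.+ b) ℚ.+ (T (+ 1) n ℚ.+ b)        ≡⟨ cong (λ z → z ℚ.+ z) half ⟩
  (t ℚ.+ t) ℚ.+ (t ℚ.+ t)                        ≡⟨ cong (λ z → (z ℚ.+ z) ℚ.+ (z ℚ.+ z)) (T-zero n) ⟩
  (a ℚ.+ a) ℚ.+ (a ℚ.+ a)                        ≡⟨ four a ⟩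
  ι (+ 4) ℚ.* a                                  ≡⟨ sym (trans (cong ι (ℤP.pos-* 4 (4 ℕ.^ n))) (ι-* (+ 4) (+ (4 ℕ.^ n)))) ⟩
  ι (+ (4 ℕ.^ suc n))                            ∎
  where
  x = + (2 ℕ.* n) ℤ.+ + 1
  b = binom x n
  t = T (+ 0) n
  a = ι (+ (4 ℕ.^ n))
  pair : ∀ b u → b ℚ.+ b ℚ.+ (u ℚ.+ u) ≡ u ℚ.+ b ℚ.+ (u ℚ.+ b)
  pair = RingSolver.solve-∀ ℚ-ring
  four : ∀ a → a ℚ.+ a ℚ.+ (a ℚ.+ a) ≡ ι (+ 4) ℚ.* a
  four = RingSolver.solve-∀ ℚ-ring
  half : T (+ 1) n ℚ.+ b ≡ t ℚ.+ t
  half = trans (cong (λ z → rowSum z n ℚ.+ b) (sym (ℤP.+-assoc (+ (2 ℕ.* n)) (+ 1) (+ 1))))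
               (rowSum-pascal x n)

lemma3p2 : (n ℓ : ℕ) → 2 ℕ.* n < ℓ →
    sumTo n (λ i → binom (+ (2 ℕ.* i) ℤ.- + ℓ) i
    ℚ.* binom (+ (2 ℕ.* (n ∸ i) ℕ.+ ℓ)) (n ∸ i))
    ≡ (+ (4 ℕ.^ n)) ℚ./ 1
lemma3p2 n ℓ _ = begin
  S (ℤ.- + ℓ) (+ ℓ) n               ≡⟨ sym (S-transfer-ℕ ℓ n (ℤ.- + ℓ) (+ 0)) ⟩
  S (ℤ.- + ℓ ℤ.+ + ℓ) (+ 0) n       ≡⟨ cong (λ r → S r (+ 0) n) (ℤP.+-inverseˡ (+ ℓ)) ⟩
  S (+ 0) (+ 0) n                   ≡⟨ S-as-T n (+ 0) ⟩
  T (+ 0) n                         ≡⟨ T-zero n ⟩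
  ι (+ (4 ℕ.^ n))                   ∎
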